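{- Let $\mathbb{K}=(G,M,I)$ be a formal context and $\mathbb{K}^c=(G,M,I^c)$ its complemented context, where $I^c=(G\times M)\setminus I$. Then: (a) for $\phi\in Fm(\mathbf{RS})_{s_1}$ and $\psi\in Fm(\mathbf{RS})_{s_2}$, $(\phi,\psi)$ is a (logical) property oriented concept of $\mathbb{K}$ if and only if $(\neg\phi,\neg\psi)$ is a (logical) object oriented concept of $\mathbb{K}$; (b) for $\mathbf{KF}$-formulas $\phi$ of sort $s_1$ and $\psi$ of sort $s_2$, $(\phi,\psi)$ is a (logical) formal concept of $\mathbb{K}$ if and only if $(\rho(\phi),\neg\rho(\psi))$ is a (logical) property oriented concept of $\mathbb{K}^c$; (c) for $\mathbf{KF}$-formulas $\phi$ of sort $s_1$ and $\psi$ of sort $s_2$, $(\phi,\psi)$ is a (logical) formal concept of $\mathbb{K}$ if and only if $(\neg\rho(\phi),\rho(\psi))$ is a (logical) object oriented concept of $\mathbb{K}^c$.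
   Context: Sorts $s_1,s_2$, disjoint nonempty variable sets $P_{s_1},P_{s_2}$. $Fm(\mathbf{RS})$: formulas of $\mathbf{KB}_2$, each sort closed under $\neg,\wedge$; $\lozenge\phi,\square\phi$ of sort $s_2$ for $\phi$ of sort $s_1$; $\lozenge^{ -1}\psi,\square^{ -1}\psi$ of sort $s_1$ for $\psi$ of sort $s_2$. $\mathbf{KF}$-formulas: same but with $\boxminus$ (sort $s_1\to s_2$) and $\boxminus^{ -1}$ (sort $s_2\to s_1$). For a context $\mathbb{L}=(G,M,J)$ its frame is $\mathfrak{C}_{\mathbb L}=(G,M,J^{ -1},J)$: worlds of sort $s_1$ are $G$, of sort $s_2$ are $M$, $R=J^{ -1}\subseteq M\times G$; a model adds a valuation $v$. Semantics: at $m\in M$, $\lozenge\phi$ iff some $g$ with $gJm$ satisfies $\phi$, $\square\phi$ iff all such $g$ do; at $g\in G$, $\lozenge^{ -1}\psi$ iff some $m$ with $gJm$ satisfies $\psi$, $\square^{ -1}\psi$ iff all such $m$ do; $\boxminus\phi$ holds at $m$ iff every $g$ satisfying $\phi$ has $gJm$; $\boxminus^{ -1}\psi$ holds at $g$ iff every $m$ satisfying $\psi$ has $gJm$. $\models^{\mathfrak{C}_{\mathbb L}}_s\chi$: $\chi$ holds at every world of sort $s$ in every model on $\mathfrak{C}_{\mathbb L}$. For context $\mathbb L$: $(\phi,\psi)$ (with $\phi,\psi\in Fm(\mathbf{RS})$ of sorts $s_1,s_2$) is a logical property oriented concept of $\mathbb L$ iff $\models_{s_1}\square^{ -1}\lozenge\phi\leftrightarrow\phi$,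 $\models_{s_2}\lozenge\square^{ -1}\psi\leftrightarrow\psi$, $\models_{s_1}\phi\leftrightarrow\square^{ -1}\psi$ and $\models_{s_2}\lozenge\phi\leftrightarrow\psi$ (all over $\mathfrak{C}_{\mathbb L}$); a logical object oriented concept iff $\models_{s_1}\lozenge^{ -1}\square\phi\leftrightarrow\phi$, $\models_{s_2}\square\lozenge^{ -1}\psi\leftrightarrow\psi$, $\models_{s_1}\phi\leftrightarrow\lozenge^{ -1}\psi$, $\models_{s_2}\square\phi\leftrightarrow\psi$. For $\mathbf{KF}$-formulas $\phi,\psi$ of sorts $s_1,s_2$: a logical formal concept of $\mathbb L$ iff $\models_{s_1}\boxminus^{ -1}\boxminus\phi\leftrightarrow\phi$, $\models_{s_2}\boxminus\boxminus^{ -1}\psi\leftrightarrow\psi$, $\models_{s_1}\phi\leftrightarrow\boxminus^{ -1}\psi$, $\models_{s_2}\boxminus\phi\leftrightarrow\psi$. Translation $\rho$ from $\mathbf{KF}$- to $\mathbf{KB}_2$-formulas (sort preserving): $\rho(p)=p$, commutes with $\neg,\wedge$, $\rho(\boxminus\phi)=\square\neg\rho(\phi)$, $\rho(\boxminus^{ -1}\psi)=\square^{ -1}\neg\rho(\psi)$. -}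

module Defs where

open import Data.Product using (Σ; _×_; _,_)
open import Relation.Nullary using (¬_)
open import Function.Bundles using (_⇔_)

data Sort : Set where
  s₁ s₂ : Sort

-- Formulas of KB₂ (Fm(RS)), over sorted variable sets Var s₁, Var s₂
-- (disjoint by construction, since they are indexed by the sort).
data Fm (Var : Sort → Set) : Sort → Set where
  var  : ∀ {s} → Var s → Fm Var s
  ~_   : ∀ {s} → Fm Var s → Fm Var s
  _∧_  : ∀ {s} → Fm Var s → Fm Var s → Fm Var s
  ◇    : Fm Var s₁ → Fm Var s₂
  □    : Fm Var s₁ → Fm Var s₂
  ◇⁻¹  : Fm Var s₂ → Fm Var s₁
  □⁻¹  : Fm Var s₂ → Fm Var s₁

data KF (Var : Sort → Set) : Sort → Set where
  var  : ∀ {s} → Var s → KF Var s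
  ~_   : ∀ {s} → KF Var s → KF Var s
  _∧_  : ∀ {s} → KF Var s → KF Var s → KF Var s
  ⊟    : KF Var s₁ → KF Var s₂
  ⊟⁻¹  : KF Var s₂ → KF Var s₁

_⟷_ : ∀ {Var s} → Fm Var s → Fm Var s → Fm Var s
φ ⟷ ψ = (~ (φ ∧ (~ ψ))) ∧ (~ (ψ ∧ (~ φ)))

_⟷ᴷ_ : ∀ {Var s} → KF Var s → KF Var s → KF Var s
φ ⟷ᴷ ψ = (~ (φ ∧ (~ ψ))) ∧ (~ (ψ ∧ (~ φ)))

record Context : Set₁ where
  field
    G : Set
    M : Set
    I : G → M → Set
open Context public

_ᶜ : Context → Context
𝕂 ᶜ = record { G = G 𝕂 ; M = M 𝕂 ; I = λ g m → ¬ I 𝕂 g m }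

-- Worlds of each sort in the frame 𝔠_𝕂 = (G, M, I⁻¹, I).
World : Context → Sort → Set
World 𝕂 s₁ = G 𝕂
World 𝕂 s₂ = M 𝕂

Valuation : (Var : Sort → Set) → Context → Set₁
Valuation Var 𝕂 = ∀ s → Var s → World 𝕂 s → Set

sat : ∀ {Var} (𝕂 : Context) → Valuation Var 𝕂 → ∀ {s} → World 𝕂 s → Fm Var s → Set
sat 𝕂 v {s} w (var p) = v s p w
sat 𝕂 v w (~ φ) = ¬ sat 𝕂 v w φ
sat 𝕂 v w (φ ∧ ψ) = sat 𝕂 v w φ × sat 𝕂 v w ψ
sat 𝕂 v m (◇ φ) = Σ (G 𝕂) λ g → I 𝕂 g m × sat 𝕂 v g φ
sat 𝕂 v m (□ φ) = ∀ g → I 𝕂 g m → sat 𝕂 v g φ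
sat 𝕂 v g (◇⁻¹ ψ) = Σ (M 𝕂) λ m → I 𝕂 g m × sat 𝕂 v m ψ
sat 𝕂 v g (□⁻¹ ψ) = ∀ m → I 𝕂 g m → sat 𝕂 v m ψ

satᴷ : ∀ {Var} (𝕂 : Context) → Valuation Var 𝕂 → ∀ {s} → World 𝕂 s → KF Var s → Set
satᴷ 𝕂 v {s} w (var p) = v s p w
satᴷ 𝕂 v w (~ φ) = ¬ satᴷ 𝕂 v w φ
satᴷ 𝕂 v w (φ ∧ ψ) = satᴷ 𝕂 v w φ × satᴷ 𝕂 v w ψ
satᴷ 𝕂 v m (⊟ φ) = ∀ g → satᴷ 𝕂 v g φ → I 𝕂 g m
satᴷ 𝕂 v g (⊟⁻¹ ψ) = ∀ m → satᴷ 𝕂 v m ψ → I 𝕂 g m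

Valid : ∀ {Var} (𝕂 : Context) (s : Sort) → Fm Var s → Set₁
Valid 𝕂 s χ = ∀ v (w : World 𝕂 s) → sat 𝕂 v w χ

Validᴷ : ∀ {Var} (𝕂 : Context) (s : Sort) → KF Var s → Set₁
Validᴷ 𝕂 s χ = ∀ v (w : World 𝕂 s) → satᴷ 𝕂 v w χ

PropConcept : ∀ {Var} (𝕂 : Context) → Fm Var s₁ → Fm Var s₂ → Set₁
PropConcept 𝕂 φ ψ =
  Valid 𝕂 s₁ (□⁻¹ (◇ φ) ⟷ φ) × Valid 𝕂 s₂ (◇ (□⁻¹ ψ) ⟷ ψ) ×
  Valid 𝕂 s₁ (φ ⟷ □⁻¹ ψ) × Valid 𝕂 s₂ (◇ φ ⟷ ψ)

ObjConcept : ∀ {Var} (𝕂 : Context) → Fm Var s₁ → Fm Var s₂ → Set₁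
ObjConcept 𝕂 φ ψ =
  Valid 𝕂 s₁ (◇⁻¹ (□ φ) ⟷ φ) × Valid 𝕂 s₂ (□ (◇⁻¹ ψ) ⟷ ψ) ×
  Valid 𝕂 s₁ (φ ⟷ ◇⁻¹ ψ) × Valid 𝕂 s₂ (□ φ ⟷ ψ)

FormalConcept : ∀ {Var} (𝕂 : Context) → KF Var s₁ → KF Var s₂ → Set₁
FormalConcept 𝕂 φ ψ =
  Validᴷ 𝕂 s₁ (⊟⁻¹ (⊟ φ) ⟷ᴷ φ) × Validᴷ 𝕂 s₂ (⊟ (⊟⁻¹ ψ) ⟷ᴷ ψ) ×
  Validᴷ 𝕂 s₁ (φ ⟷ᴷ ⊟⁻¹ ψ) × Validᴷ 𝕂 s₂ (⊟ φ ⟷ᴷ ψ)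

ρ : ∀ {Var s} → KF Var s → Fm Var s
ρ (var p) = var p
ρ (~ φ) = ~ ρ φ
ρ (φ ∧ ψ) = ρ φ ∧ ρ ψ
ρ (⊟ φ) = □ (~ ρ φ)
ρ (⊟⁻¹ ψ) = □⁻¹ (~ ρ ψ)

{-# OPTIONS --safe #-}
-- ◇ and □, and likewise ◇⁻¹ and □⁻¹, are classically De Morgan dual, and a
-- biconditional holds iff the biconditional of the two negations does. Negating both
-- sides of the four defining biconditionals of a property oriented concept (φ, ψ)
-- therefore gives those of the object oriented concept (¬φ, ¬ψ).
-- ⊟φ holds at m iff no g with g Iᶜ m satisfies φ (by contraposition), so ⊟ is □ ∘ ¬
-- read in 𝕂ᶜ, and ρ carries the KF-semantics over 𝕂 to the KB₂-semantics over 𝕂ᶜ.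
-- The formal concept conditions of (φ, ψ) thereby become the property oriented ones
-- of (ρφ, ¬ρψ), and (c) follows from (b) and (a) since ¬¬ρψ is equivalent to ρψ.
module Submission where

open import Defs
open import Level using (0ℓ)
open import Data.Product using (Σ; _×_; _,_; proj₁; proj₂)
open import Data.Product.Function.NonDependent.Propositional using (_×-⇔_)
open import Function.Bundles using (_⇔_; mk⇔; Equivalence)
open import Function.Properties.Equivalence
  using () renaming (refl to ⇔-refl; sym to ⇔-sym; trans to ⇔-trans)
open import Function.Related.TypeIsomorphisms using (¬-cong-⇔)
open import Axiom.ExcludedMiddle using (ExcludedMiddle)
open import Axiom.DoubleNegationElimination using (em⇒dne)
open import Relation.Nullary using (¬_)

open Equivalence using (to; from)

module _ {X : Set} {R A B : X → Set} where

  ∃-rel-cong : (∀ x → A x ⇔ B x) → Σ X (λ x → R x × A x) ⇔ Σ X (λ x → R x × B x)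
  ∃-rel-cong e = mk⇔ (λ (x , r , a) → x , r , to (e x) a)
                     (λ (x , r , b) → x , r , from (e x) b)

  ∀-rel-cong : (∀ x → A x ⇔ B x) → ((x : X) → R x → A x) ⇔ ((x : X) → R x → B x)
  ∀-rel-cong e = mk⇔ (λ h x r → to (e x) (h x r)) (λ h x r → from (e x) (h x r))

module _ {X : Set} {R A : X → Set} where

  ¬∃-rel⇔∀¬ : (¬ Σ X (λ x → R x × A x)) ⇔ ((x : X) → R x → ¬ A x)
  ¬∃-rel⇔∀¬ = mk⇔ (λ ¬∃ x r a → ¬∃ (x , r , a)) (λ ∀¬ (x , r , a) → ∀¬ x r a)

  ¬∀-rel⇔∃¬ : ExcludedMiddle 0ℓ → (¬ ((x : X) → R x → A x)) ⇔ Σ X (λ x → R x × ¬ A x)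
  ¬∀-rel⇔∃¬ em = mk⇔
    (λ ¬∀ → dne λ ¬∃ → ¬∀ λ x r → dne λ ¬a → ¬∃ (x , r , ¬a))
    (λ (x , r , ¬a) ∀a → ¬a (∀a x r))
    where dne = em⇒dne em

∀-contraposition⇔ : ExcludedMiddle 0ℓ → {X : Set} {R A B : X → Set} →
  (∀ x → A x ⇔ B x) → ((x : X) → A x → R x) ⇔ ((x : X) → ¬ R x → ¬ B x)
∀-contraposition⇔ em e = mk⇔
  (λ h x ¬r b → ¬r (h x (from (e x) b)))
  (λ h x a → em⇒dne em λ ¬r → h x ¬r (to (e x) a))

¬¬-elim⇔ : ExcludedMiddle 0ℓ → {A : Set} → (¬ ¬ A) ⇔ A
¬¬-elim⇔ em = mk⇔ (em⇒dne em) (λ a ¬a → ¬a a)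

bicond⇔bicond-¬ : {P Q : Set} →
  (¬ (P × ¬ Q) × ¬ (Q × ¬ P)) ⇔ (¬ (¬ P × ¬ ¬ Q) × ¬ (¬ Q × ¬ ¬ P))
bicond⇔bicond-¬ = mk⇔
  (λ (p⇒q , q⇒p) → (λ (¬p , ¬¬q) → ¬¬q λ q → q⇒p (q , ¬p))
                 , (λ (¬q , ¬¬p) → ¬¬p λ p → p⇒q (p , ¬q)))
  (λ (¬p⇒¬q , ¬q⇒¬p) → (λ (p , ¬q) → ¬q⇒¬p (¬q , λ ¬p → ¬p p))
                     , (λ (q , ¬p) → ¬p⇒¬q (¬p , λ ¬q → ¬q q)))

⊟ᵨ : ∀ {Var} → Fm Var s₁ → Fm Var s₂
⊟ᵨ φ = □ (~ φ)

⊟⁻¹ᵨ : ∀ {Var} → Fm Var s₂ → Fm Var s₁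
⊟⁻¹ᵨ ψ = □⁻¹ (~ ψ)

FormalConceptᵨ : ∀ {Var} (ℂ : Context) → Fm Var s₁ → Fm Var s₂ → Set₁
FormalConceptᵨ ℂ φ ψ =
  Valid ℂ s₁ (⊟⁻¹ᵨ (⊟ᵨ φ) ⟷ φ) × Valid ℂ s₂ (⊟ᵨ (⊟⁻¹ᵨ ψ) ⟷ ψ) ×
  Valid ℂ s₁ (φ ⟷ ⊟⁻¹ᵨ ψ) × Valid ℂ s₂ (⊟ᵨ φ ⟷ ψ)

module Semantics {Var : Sort → Set} (ℂ : Context) where

  infix 4 _≈_
  record _≈_ {s} (φ ψ : Fm Var s) : Set₁ where
    constructor mk≈
    field sat⇔ : ∀ v w → sat ℂ v w φ ⇔ sat ℂ v w ψ
  open _≈_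

  module _ {s : Sort} where

    ≈-refl : {φ : Fm Var s} → φ ≈ φ
    ≈-refl = mk≈ λ v w → ⇔-refl

    ≈-trans : {φ ψ χ : Fm Var s} → φ ≈ ψ → ψ ≈ χ → φ ≈ χ
    ≈-trans e f = mk≈ λ v w → ⇔-trans (sat⇔ e v w) (sat⇔ f v w)

    ~-cong : {φ φ′ : Fm Var s} → φ ≈ φ′ → ~ φ ≈ ~ φ′
    ~-cong e = mk≈ λ v w → ¬-cong-⇔ (sat⇔ e v w)

    ∧-cong : {φ φ′ ψ ψ′ : Fm Var s} → φ ≈ φ′ → ψ ≈ ψ′ → φ ∧ ψ ≈ φ′ ∧ ψ′
    ∧-cong e f = mk≈ λ v w → sat⇔ e v w ×-⇔ sat⇔ f v w

    ⟷-cong : {φ φ′ ψ ψ′ : Fm Var s} → φ ≈ φ′ → ψ ≈ ψ′ → (φ ⟷ ψ) ≈ (φ′ ⟷ ψ′)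
    ⟷-cong e f = ∧-cong (~-cong (∧-cong e (~-cong f))) (~-cong (∧-cong f (~-cong e)))

    ⟷≈⟷-~ : {φ ψ : Fm Var s} → (φ ⟷ ψ) ≈ ((~ φ) ⟷ (~ ψ))
    ⟷≈⟷-~ = mk≈ λ v w → bicond⇔bicond-¬

    ⟷-cong-~ : {φ φ′ ψ ψ′ : Fm Var s} → ~ φ ≈ φ′ → ~ ψ ≈ ψ′ → (φ ⟷ ψ) ≈ (φ′ ⟷ ψ′)
    ⟷-cong-~ e f = ≈-trans ⟷≈⟷-~ (⟷-cong e f)

    Valid-resp-≈ : {φ ψ : Fm Var s} → φ ≈ ψ → Valid ℂ s φ ⇔ Valid ℂ s ψ
    Valid-resp-≈ e = mk⇔ (λ h v w → to (sat⇔ e v w) (h v w))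
                         (λ h v w → from (sat⇔ e v w) (h v w))

  module _ {φ φ′ : Fm Var s₁} where

    ◇-cong : φ ≈ φ′ → ◇ φ ≈ ◇ φ′
    ◇-cong e = mk≈ λ v m → ∃-rel-cong (sat⇔ e v)

    □-cong : φ ≈ φ′ → □ φ ≈ □ φ′
    □-cong e = mk≈ λ v m → ∀-rel-cong (sat⇔ e v)

  module _ {ψ ψ′ : Fm Var s₂} where

    ◇⁻¹-cong : ψ ≈ ψ′ → ◇⁻¹ ψ ≈ ◇⁻¹ ψ′
    ◇⁻¹-cong e = mk≈ λ v g → ∃-rel-cong (sat⇔ e v)

    □⁻¹-cong : ψ ≈ ψ′ → □⁻¹ ψ ≈ □⁻¹ ψ′
    □⁻¹-cong e = mk≈ λ v g → ∀-rel-cong (sat⇔ e v)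

  ~◇≈□~ : (φ : Fm Var s₁) → ~ ◇ φ ≈ □ (~ φ)
  ~◇≈□~ _ = mk≈ λ v m → ¬∃-rel⇔∀¬

  objConcept-respʳ-≈ : (φ : Fm Var s₁) {ψ ψ′ : Fm Var s₂} →
    ψ ≈ ψ′ → ObjConcept ℂ φ ψ ⇔ ObjConcept ℂ φ ψ′
  objConcept-respʳ-≈ φ e =
    ⇔-refl ×-⇔
    Valid-resp-≈ (⟷-cong (□-cong (◇⁻¹-cong e)) e) ×-⇔
    Valid-resp-≈ (⟷-cong (≈-refl {φ = φ}) (◇⁻¹-cong e)) ×-⇔
    Valid-resp-≈ (⟷-cong (≈-refl {φ = □ φ}) e)

  module Classical (em : ExcludedMiddle 0ℓ) where

    ~~≈id : ∀ {s} (φ : Fm Var s) → ~ ~ φ ≈ φ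
    ~~≈id _ = mk≈ λ v w → ¬¬-elim⇔ em

    ~□≈◇~ : (φ : Fm Var s₁) → ~ □ φ ≈ ◇ (~ φ)
    ~□≈◇~ _ = mk≈ λ v m → ¬∀-rel⇔∃¬ em

    ~□⁻¹≈◇⁻¹~ : (ψ : Fm Var s₂) → ~ □⁻¹ ψ ≈ ◇⁻¹ (~ ψ)
    ~□⁻¹≈◇⁻¹~ _ = mk≈ λ v g → ¬∀-rel⇔∃¬ em

    propConcept⇔objConcept-~ : (φ : Fm Var s₁) (ψ : Fm Var s₂) →
      PropConcept ℂ φ ψ ⇔ ObjConcept ℂ (~ φ) (~ ψ)
    propConcept⇔objConcept-~ φ ψ =
      Valid-resp-≈ (⟷-cong-~ (≈-trans (~□⁻¹≈◇⁻¹~ (◇ φ)) (◇⁻¹-cong (~◇≈□~ φ)))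
                             (≈-refl {φ = ~ φ})) ×-⇔
      Valid-resp-≈ (⟷-cong-~ (≈-trans (~◇≈□~ (□⁻¹ ψ)) (□-cong (~□⁻¹≈◇⁻¹~ ψ)))
                             (≈-refl {φ = ~ ψ})) ×-⇔
      Valid-resp-≈ (⟷-cong-~ (≈-refl {φ = ~ φ}) (~□⁻¹≈◇⁻¹~ ψ)) ×-⇔
      Valid-resp-≈ (⟷-cong-~ (~◇≈□~ φ) (≈-refl {φ = ~ ψ}))

    formalConceptᵨ⇔propConcept-~ʳ : (φ : Fm Var s₁) (ψ : Fm Var s₂) →
      FormalConceptᵨ ℂ φ ψ ⇔ PropConcept ℂ φ (~ ψ)
    formalConceptᵨ⇔propConcept-~ʳ φ ψ =
      Valid-resp-≈ (⟷-cong (□⁻¹-cong (≈-trans (~□≈◇~ (~ φ)) (◇-cong (~~≈id φ))))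
                           (≈-refl {φ = φ})) ×-⇔
      ⇔-sym (Valid-resp-≈ (⟷-cong-~ (~◇≈□~ (⊟⁻¹ᵨ ψ)) (~~≈id ψ))) ×-⇔
      ⇔-refl ×-⇔
      ⇔-sym (Valid-resp-≈ (⟷-cong-~ (~◇≈□~ φ) (~~≈id ψ)))

    formalConceptᵨ⇔objConcept-~ˡ : (φ : Fm Var s₁) (ψ : Fm Var s₂) →
      FormalConceptᵨ ℂ φ ψ ⇔ ObjConcept ℂ (~ φ) ψ
    formalConceptᵨ⇔objConcept-~ˡ φ ψ =
      ⇔-trans (formalConceptᵨ⇔propConcept-~ʳ φ ψ)
        (⇔-trans (propConcept⇔objConcept-~ φ (~ ψ)) (objConcept-respʳ-≈ (~ φ) (~~≈id ψ)))

module Complement (em : ExcludedMiddle 0ℓ) {Var : Sort → Set} (𝕂 : Context) where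

  -- World 𝕂 s and World (𝕂 ᶜ) s coincide only for a concrete sort, so valuations
  -- of 𝕂 and 𝕂ᶜ are distinct types and are related sort by sort.
  Agree : Valuation Var 𝕂 → Valuation Var (𝕂 ᶜ) → Set
  Agree v v′ = (∀ p g → v s₁ p g ⇔ v′ s₁ p g) × (∀ p m → v s₂ p m ⇔ v′ s₂ p m)

  toᶜ : Valuation Var 𝕂 → Valuation Var (𝕂 ᶜ)
  toᶜ v s₁ = v s₁
  toᶜ v s₂ = v s₂

  fromᶜ : Valuation Var (𝕂 ᶜ) → Valuation Var 𝕂
  fromᶜ v′ s₁ = v′ s₁
  fromᶜ v′ s₂ = v′ s₂

  toᶜ-agree : ∀ v → Agree v (toᶜ v)
  toᶜ-agree v = (λ _ _ → ⇔-refl) , (λ _ _ → ⇔-refl)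

  fromᶜ-agree : ∀ v′ → Agree (fromᶜ v′) v′
  fromᶜ-agree v′ = (λ _ _ → ⇔-refl) , (λ _ _ → ⇔-refl)

  module _ {v v′} (agree : Agree v v′) where

    satᴷ⇔sat-ρ₁ : (φ : KF Var s₁) (g : G 𝕂) → satᴷ 𝕂 v g φ ⇔ sat (𝕂 ᶜ) v′ g (ρ φ)
    satᴷ⇔sat-ρ₂ : (ψ : KF Var s₂) (m : M 𝕂) → satᴷ 𝕂 v m ψ ⇔ sat (𝕂 ᶜ) v′ m (ρ ψ)

    satᴷ⇔sat-ρ₁ (var p) g = proj₁ agree p g
    satᴷ⇔sat-ρ₁ (~ φ) g = ¬-cong-⇔ (satᴷ⇔sat-ρ₁ φ g)
    satᴷ⇔sat-ρ₁ (φ ∧ φ′) g = satᴷ⇔sat-ρ₁ φ g ×-⇔ satᴷ⇔sat-ρ₁ φ′ g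
    satᴷ⇔sat-ρ₁ (⊟⁻¹ ψ) g = ∀-contraposition⇔ em (satᴷ⇔sat-ρ₂ ψ)

    satᴷ⇔sat-ρ₂ (var p) m = proj₂ agree p m
    satᴷ⇔sat-ρ₂ (~ ψ) m = ¬-cong-⇔ (satᴷ⇔sat-ρ₂ ψ m)
    satᴷ⇔sat-ρ₂ (ψ ∧ ψ′) m = satᴷ⇔sat-ρ₂ ψ m ×-⇔ satᴷ⇔sat-ρ₂ ψ′ m
    satᴷ⇔sat-ρ₂ (⊟ φ) m = ∀-contraposition⇔ em (satᴷ⇔sat-ρ₁ φ)

  Validᴷ⇔Valid-ρ : ∀ {s} (χ : KF Var s) → Validᴷ 𝕂 s χ ⇔ Valid (𝕂 ᶜ) s (ρ χ)
  Validᴷ⇔Valid-ρ {s₁} χ = mk⇔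
    (λ h v′ g → to (satᴷ⇔sat-ρ₁ (fromᶜ-agree v′) χ g) (h (fromᶜ v′) g))
    (λ h v g → from (satᴷ⇔sat-ρ₁ (toᶜ-agree v) χ g) (h (toᶜ v) g))
  Validᴷ⇔Valid-ρ {s₂} χ = mk⇔
    (λ h v′ m → to (satᴷ⇔sat-ρ₂ (fromᶜ-agree v′) χ m) (h (fromᶜ v′) m))
    (λ h v m → from (satᴷ⇔sat-ρ₂ (toᶜ-agree v) χ m) (h (toᶜ v) m))

  formalConcept⇔formalConceptᵨᶜ : (φ : KF Var s₁) (ψ : KF Var s₂) →
    FormalConcept 𝕂 φ ψ ⇔ FormalConceptᵨ (𝕂 ᶜ) (ρ φ) (ρ ψ)
  formalConcept⇔formalConceptᵨᶜ φ ψ =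
    Validᴷ⇔Valid-ρ (⊟⁻¹ (⊟ φ) ⟷ᴷ φ) ×-⇔ Validᴷ⇔Valid-ρ (⊟ (⊟⁻¹ ψ) ⟷ᴷ ψ) ×-⇔
    Validᴷ⇔Valid-ρ (φ ⟷ᴷ ⊟⁻¹ ψ) ×-⇔ Validᴷ⇔Valid-ρ (⊟ φ ⟷ᴷ ψ)

proposition7 : ExcludedMiddle 0ℓ →
    (Var : Sort → Set) → Var s₁ → Var s₂ → (𝕂 : Context) →
    (∀ (φ : Fm Var s₁) (ψ : Fm Var s₂) →
       PropConcept 𝕂 φ ψ ⇔ ObjConcept 𝕂 (~ φ) (~ ψ)) ×
    (∀ (φ : KF Var s₁) (ψ : KF Var s₂) →
       FormalConcept 𝕂 φ ψ ⇔ PropConcept (𝕂 ᶜ) (ρ φ) (~ ρ ψ)) ×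
    (∀ (φ : KF Var s₁) (ψ : KF Var s₂) →
       FormalConcept 𝕂 φ ψ ⇔ ObjConcept (𝕂 ᶜ) (~ ρ φ) (ρ ψ))
proposition7 em Var _ _ 𝕂 =
  K.propConcept⇔objConcept-~ ,
  (λ φ ψ → ⇔-trans (formalConcept⇔formalConceptᵨᶜ φ ψ)
                    (Kᶜ.formalConceptᵨ⇔propConcept-~ʳ (ρ φ) (ρ ψ))) ,
  (λ φ ψ → ⇔-trans (formalConcept⇔formalConceptᵨᶜ φ ψ)
                    (Kᶜ.formalConceptᵨ⇔objConcept-~ˡ (ρ φ) (ρ ψ)))
  where
  module K = Semantics.Classical {Var} 𝕂 em
  module Kᶜ = Semantics.Classical {Var} (𝕂 ᶜ) em
  open Complement em {Var} 𝕂
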